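{- For all $E\in\mathcal P^e$ and $\rho\in\mathcal O^e$: if $E$ wfmust $\rho$ then $E$ sfmust $\rho$. The converse does not hold: there exist $E\in\mathcal P^e$ and $\rho\in\mathcal O^e$ with $E$ sfmust $\rho$ but not $E$ wfmust $\rho$.
   Context: Unlabeled processes. Let $\mathcal N$ be an infinite set of names and $\omega\notin\mathcal N$ a special success action. Processes $\mathcal P$: $P::=0\mid x(y).P\mid \bar xy.P\mid P\,|\,P\mid(\nu x)P\mid\, !P$; observers $\mathcal O$: the same grammar extended with $\omega.P$. Binders, $fn$, $bn$, $n(\cdot)$ as usual (alpha-conversion assumed; $fn(\omega)=bn(\omega)=\emptyset$). Actions $\mu$: $xy$, $\bar xy$, $\bar x(y)$, $\tau$ (and $\omega$), with $bn(\bar x(y))=\{y\}$, otherwise empty, $fn(xy)=fn(\bar xy)=\{x,y\}$, $fn(\bar x(y))=\{x\}$, $fn(\tau)=\emptyset$. Transitions: Input $x(y).P\xrightarrow{xz}P\{z/y\}$; Output $\bar xy.P\xrightarrow{\bar xy}P$; $\omega.P\xrightarrow{\omega}P$; Open: $P\xrightarrow{\bar xy}P'$, $x\ne y$ imply $(\nu y)P\xrightarrow{\bar x(y)}P'$; Res: $P\xrightarrow{\mu}P'$, $y\notin n(\mu)$ imply $(\nu y)P\xrightarrow{\mu}(\nu y)P'$; Par: $P\xrightarrow{\mu}P'$, $bn(\mu)\cap fn(Q)=\emptyset$ imply $P|Q\xrightarrow{\mu}P'|Q$; Com: $P\xrightarrow{xy}P'$, $Q\xrightarrow{\bar xy}Q'$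 imply $P|Q\xrightarrow{\tau}P'|Q'$; Close: $P\xrightarrow{xy}P'$, $Q\xrightarrow{\bar x(y)}Q'$, $y\notin fn(P)$ imply $P|Q\xrightarrow{\tau}(\nu y)(P'|Q')$; symmetric versions of Par, Com, Close; Rep: $P\xrightarrow{\mu}P'$ implies $!P\xrightarrow{\mu}P'|!P$. Labeled terms. Labels are pairs $\langle s,n\rangle\in\{0,1\}^*\times\mathbb N$; $s_0\sqsubseteq s_1$ means $s_0$ is a prefix of $s_1$; for label sets, $L_0\,\Re\,L_1$ iff for all $\langle s_0,n_0\rangle\in L_0$, $\langle s_1,n_1\rangle\in L_1$: $s_0\not\sqsubseteq s_1$ and $s_1\not\sqsubseteq s_0$. Ground labeled terms: $E::=0\mid \mu_{\langle s,n\rangle}.E\mid(\nu x)E\mid E\,|\,E\mid\, !_{\langle s,n\rangle}P\mid \omega.o$, where $\mu$ is a prefix $x(y)$ or $\bar xy$, $P$ is unlabeled, and $o\in\mathcal O$ is an unlabeled observer. Labeling function: $L_{\langle s,n\rangle}(0)=0$; $L_{\langle s,n\rangle}(\mu.P)=\mu_{\langle s,n\rangle}.L_{\langle s,n+1\rangle}(P)$; $L_{\langle s,n\rangle}(P_0|P_1)=L_{\langle s0,n\rangle}(P_0)|L_{\langle s1,n\rangle}(P_1)$; $L_{\langle s,n\rangle}((\nu x)P)=(\nu x)L_{\langle s,n\rangle}(P)$; $L_{\langle s,n\rangle}(!P)=\,!_{\langle s,n\rangle}P$; $L_{\langle s,n\rangle}(\omega.o)=\omega.o$. $top(0)=lab(0)=top(\omega.o)=lab(\omega.o)=\emptyset$;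 $top(\mu_v.E)=\{v\}$, $lab(\mu_v.E)=\{v\}\cup lab(E)$; $top,lab$ of $(\nu x)E$ equal those of $E$; $top$, $lab$ of $E_0|E_1$ are unions; $top(!_vP)=lab(!_vP)=\{v\}$. $wf$ is the least predicate with: $wf(0)$; $wf(\omega.o)$; $wf(L_{\langle s,n\rangle}(\mu.P))$ for every prefixed process/observer $\mu.P$ and label; $wf(E_0|E_1)$ if $wf(E_0)$, $wf(E_1)$, $top(E_0)\,\Re\,top(E_1)$; $wf((\nu x)E)$ if $wf(E)$; $wf(!_{\langle s,n\rangle}P)$ for every $P$ and label. $\mathcal P^e$ (resp. $\mathcal O^e$) is the set of well-formed labeled terms built from processes (resp. observers). Labeled transitions use the unlabeled rules with labels ignored (e.g. $x(y)_v.E\xrightarrow{xz}E\{z/y\}$, $\bar xy_v.E\xrightarrow{\bar xy}E$, $\omega.o\xrightarrow{\omega}o$), except replication: if $P\xrightarrow{\mu}P'$ (unlabeled) then $!_{\langle s,n\rangle}P\xrightarrow{\mu}L_{\langle s0,n+1\rangle}(P')\,|\,!_{\langle s1,n+1\rangle}P$. Live labels. $live(v,\mu,S)$ is the least predicate closed under: $live(\langle s,n\rangle,xz,x(y)_{\langle s,n\rangle}.S)$; $live(\langle s,n\rangle,\bar xz,\bar xz_{\langle s,n\rangle}.S)$; Res: $live(v,\mu,S)$, $y\notin n(\mu)$ imply $live(v,\mu,(\nu y)S)$; Open: $live(v,\bar xy,S)$, $x\ne y$ imply $live(v,\bar x(y),(\nu y)S)$; Rep: if $P\xrightarrow{\mu}P'$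 then $live(\langle s,n\rangle,\mu,!_{\langle s,n\rangle}P)$; Par: $live(v,\mu,S_0)$, $bn(\mu)\cap fn(S_1)=\emptyset$ imply $live(v,\mu,S_0|S_1)$; Com: $live(v,xy,S_0)$, $live(w,\bar xy,S_1)$ imply $live(v,\tau,S_0|S_1)$ and $live(w,\tau,S_0|S_1)$; Close: $live(v,xy,S_0)$, $live(w,\bar x(y),S_1)$, $y\notin fn(S_0)$ imply $live(v,\tau,(\nu y)(S_0|S_1))$ and $live(w,\tau,(\nu y)(S_0|S_1))$ (together with symmetric versions of Par, Com, Close). $Ll(S)=\{v: live(v,\tau,S)\}$. Computations. A maximal computation from $S$ is either an infinite sequence $S=S_0\xrightarrow{\tau}S_1\xrightarrow{\tau}\cdots$ or a finite one $S=S_0\xrightarrow{\tau}\cdots\xrightarrow{\tau}S_n$ with no $\tau$-transition from $S_n$. It is weak-fair if for every label $v$ and every index $i$ there is an index $j\ge i$ with $v\notin Ll(S_j)$; strong-fair if for every label $v$ there is an index $i$ with $v\notin Ll(S_j)$ for all indices $j\ge i$ (indices range over the states of the computation). For $E\in\mathcal P^e$, $\rho\in\mathcal O^e$: $E$ sfmust $\rho$ (resp. $E$ wfmust $\rho$) iff for every strong-fair (resp. weak-fair) computation $E|\rho=S_0\xrightarrow{\tau}S_1\xrightarrow{\tau}\cdots$ there is $i$ with $S_i\xrightarrow{\omega}$. -}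

module Defs where

open import Data.Nat using (ℕ; zero; suc; _≤_; _≟_)
open import Data.Bool using (Bool; true; false; if_then_else_)
open import Data.List using (List; []; _∷_; _++_; [_]; filter)
open import Data.List.Membership.Propositional using (_∈_; _∉_)
open import Data.List.Relation.Unary.All using (All)
open import Data.Maybe using (Maybe; just; nothing)
open import Data.Product using (Σ; ∃; _×_; _,_; proj₁)
open import Data.Unit using (⊤)
open import Relation.Nullary using (¬_; Dec; yes; no)
open import Relation.Nullary.Decidable using (¬?)
open import Relation.Binary.PropositionalEquality using (_≡_; _≢_)

Name : Set
Name = ℕ

-- Unlabeled terms.  One syntax for observers 𝒪; processes 𝒫 are the
-- ω-free observers (predicate IsProc below).

data Obs : Set where
  𝟘    : Obs
  inp  : Name → Name → Obs → Obs   -- x(y).P   (y bound)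
  out  : Name → Name → Obs → Obs
  _∣_  : Obs → Obs → Obs
  ν    : Name → Obs → Obs          -- (νx)P    (x bound)
  !_   : Obs → Obs
  ω∙_  : Obs → Obs

data IsProc : Obs → Set where
  p𝟘   : IsProc 𝟘
  pinp : ∀ {x y P} → IsProc P → IsProc (inp x y P)
  pout : ∀ {x y P} → IsProc P → IsProc (out x y P)
  ppar : ∀ {P Q} → IsProc P → IsProc Q → IsProc (P ∣ Q)
  pν   : ∀ {x P} → IsProc P → IsProc (ν x P)
  p!   : ∀ {P} → IsProc P → IsProc (! P)

remove : Name → List Name → List Name
remove y = filter (λ z → ¬? (z ≟ y))

fn : Obs → List Name
fn 𝟘         = []
fn (inp x y P) = x ∷ remove y (fn P)
fn (out x y P) = x ∷ y ∷ fn P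
fn (P ∣ Q)   = fn P ++ fn Q
fn (ν x P)   = remove x (fn P)
fn (! P)     = fn P
fn (ω∙ P)    = fn P

bnAll : Obs → List Name
bnAll 𝟘         = []
bnAll (inp x y P) = y ∷ bnAll P
bnAll (out x y P) = bnAll P
bnAll (P ∣ Q)   = bnAll P ++ bnAll Q
bnAll (ν x P)   = x ∷ bnAll P
bnAll (! P)     = bnAll P
bnAll (ω∙ P)    = bnAll P

swapN : Name → Name → Name → Name
swapN a b n with n ≟ a
... | yes _ = b
... | no _ with n ≟ b
...   | yes _ = a
...   | no _  = n

swap : Name → Name → Obs → Obs
swap a b 𝟘         = 𝟘
swap a b (inp x y P) = inp (swapN a b x) (swapN a b y) (swap a b P)
swap a b (out x y P) = out (swapN a b x) (swapN a b y) (swap a b P)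
swap a b (P ∣ Q)   = swap a b P ∣ swap a b Q
swap a b (ν x P)   = ν (swapN a b x) (swap a b P)
swap a b (! P)     = ! (swap a b P)
swap a b (ω∙ P)    = ω∙ (swap a b P)

rnN : Name → Name → Name → Name
rnN z y n with n ≟ y
... | yes _ = z
... | no _  = n

-- It is capture-avoiding
-- whenever z ∉ bnAll P, which is required where it is used; by the
-- alpha-conversion rules every substitution instance is reachable.
subst : Name → Name → Obs → Obs
subst z y 𝟘         = 𝟘
subst z y (inp x b P) with b ≟ y
... | yes _ = inp (rnN z y x) b P
... | no _  = inp (rnN z y x) b (subst z y P)
subst z y (out x b P) = out (rnN z y x) (rnN z y b) (subst z y P)
subst z y (P ∣ Q)   = subst z y P ∣ subst z y Q
subst z y (ν b P) with b ≟ y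
... | yes _ = ν b P
... | no _  = ν b (subst z y P)
subst z y (! P)     = ! (subst z y P)
subst z y (ω∙ P)    = ω∙ (subst z y P)

data _≈α_ : Obs → Obs → Set where
  α𝟘    : 𝟘 ≈α 𝟘
  αinp  : ∀ {x y P P'} → P ≈α P' → inp x y P ≈α inp x y P'
  αinp' : ∀ {x y y' P P'} → y ≢ y' → y ∉ fn P' → P ≈α swap y y' P' →
          inp x y P ≈α inp x y' P'
  αout  : ∀ {x y P P'} → P ≈α P' → out x y P ≈α out x y P'
  αpar  : ∀ {P Q P' Q'} → P ≈α P' → Q ≈α Q' → (P ∣ Q) ≈α (P' ∣ Q')
  αν    : ∀ {y P P'} → P ≈α P' → ν y P ≈α ν y P'
  αν'   : ∀ {y y' P P'} → y ≢ y' → y ∉ fn P' → P ≈α swap y y' P' →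
          ν y P ≈α ν y' P'
  α!    : ∀ {P P'} → P ≈α P' → (! P) ≈α (! P')
  αω    : ∀ {P P'} → P ≈α P' → (ω∙ P) ≈α (ω∙ P')

-- Actions (other than ω, which is treated separately via CanSucc)

data Act : Set where
  inA  : Name → Name → Act
  outA : Name → Name → Act
  boutA : Name → Name → Act
  τ    : Act

namesA : Act → List Name
namesA (inA x y)   = x ∷ y ∷ []
namesA (outA x y)  = x ∷ y ∷ []
namesA (boutA x y) = x ∷ y ∷ []
namesA τ           = []

bnA : Act → List Name
bnA (boutA x y) = [ y ]
bnA _           = []

Disj : List Name → List Name → Set
Disj xs ys = All (λ b → b ∉ ys) xs

infix 4 _⟶[_]_
data _⟶[_]_ : Obs → Act → Obs → Set where
  tInp   : ∀ {x y z P} → z ∉ bnAll P → inp x y P ⟶[ inA x z ] subst z y P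
  tOut   : ∀ {x y P} → out x y P ⟶[ outA x y ] P
  tOpen  : ∀ {x y P P'} → P ⟶[ outA x y ] P' → x ≢ y → ν y P ⟶[ boutA x y ] P'
  tRes   : ∀ {y μ P P'} → P ⟶[ μ ] P' → y ∉ namesA μ → ν y P ⟶[ μ ] ν y P'
  tParL  : ∀ {μ P P' Q} → P ⟶[ μ ] P' → Disj (bnA μ) (fn Q) → (P ∣ Q) ⟶[ μ ] (P' ∣ Q)
  tParR  : ∀ {μ P Q Q'} → Q ⟶[ μ ] Q' → Disj (bnA μ) (fn P) → (P ∣ Q) ⟶[ μ ] (P ∣ Q')
  tComL  : ∀ {x y P P' Q Q'} → P ⟶[ inA x y ] P' → Q ⟶[ outA x y ] Q' → (P ∣ Q) ⟶[ τ ] (P' ∣ Q')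
  tComR  : ∀ {x y P P' Q Q'} → P ⟶[ outA x y ] P' → Q ⟶[ inA x y ] Q' → (P ∣ Q) ⟶[ τ ] (P' ∣ Q')
  tCloseL : ∀ {x y P P' Q Q'} → P ⟶[ inA x y ] P' → Q ⟶[ boutA x y ] Q' → y ∉ fn P →
            (P ∣ Q) ⟶[ τ ] ν y (P' ∣ Q')
  tCloseR : ∀ {x y P P' Q Q'} → P ⟶[ boutA x y ] P' → Q ⟶[ inA x y ] Q' → y ∉ fn Q →
            (P ∣ Q) ⟶[ τ ] ν y (P' ∣ Q')
  tRep   : ∀ {μ P P'} → P ⟶[ μ ] P' → (! P) ⟶[ μ ] (P' ∣ (! P))
  tAlpha : ∀ {μ P P₁ P₂ P'} → P ≈α P₁ → P₁ ⟶[ μ ] P₂ → P₂ ≈α P' → P ⟶[ μ ] P'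

-- P —ω→ (existence of an ω-transition)
data CanSuccU : Obs → Set where
  sω   : ∀ {P} → CanSuccU (ω∙ P)
  sRes : ∀ {y P} → CanSuccU P → CanSuccU (ν y P)
  sParL : ∀ {P Q} → CanSuccU P → CanSuccU (P ∣ Q)
  sParR : ∀ {P Q} → CanSuccU Q → CanSuccU (P ∣ Q)
  sRep : ∀ {P} → CanSuccU P → CanSuccU (! P)

Label : Set
Label = List Bool × ℕ

_⊑_ : List Bool → List Bool → Set
s₀ ⊑ s₁ = ∃ λ t → s₀ ++ t ≡ s₁

_ℜ_ : List Label → List Label → Set
L₀ ℜ L₁ = ∀ l₀ l₁ → l₀ ∈ L₀ → l₁ ∈ L₁ →
          ¬ (proj₁ l₀ ⊑ proj₁ l₁) × ¬ (proj₁ l₁ ⊑ proj₁ l₀)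

data LT : Set where
  𝟘ₗ    : LT
  inpₗ  : Label → Name → Name → LT → LT
  outₗ  : Label → Name → Name → LT → LT
  _∣ₗ_  : LT → LT → LT
  νₗ    : Name → LT → LT
  !ₗ    : Label → Obs → LT
  ωₗ    : Obs → LT

Lab : List Bool → ℕ → Obs → LT
Lab s n 𝟘         = 𝟘ₗ
Lab s n (inp x y P) = inpₗ (s , n) x y (Lab s (suc n) P)
Lab s n (out x y P) = outₗ (s , n) x y (Lab s (suc n) P)
Lab s n (P ∣ Q)   = Lab (s ++ [ false ]) n P ∣ₗ Lab (s ++ [ true ]) n Q
Lab s n (ν x P)   = νₗ x (Lab s n P)
Lab s n (! P)     = !ₗ (s , n) P
Lab s n (ω∙ o)    = ωₗ o

top : LT → List Label
top 𝟘ₗ            = []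
top (inpₗ v x y E) = [ v ]
top (outₗ v x y E) = [ v ]
top (E ∣ₗ F)      = top E ++ top F
top (νₗ x E)      = top E
top (!ₗ v P)      = [ v ]
top (ωₗ o)        = []

data wf : LT → Set where
  wf𝟘   : wf 𝟘ₗ
  wfω   : ∀ {o} → wf (ωₗ o)
  wfinp : ∀ s n x y P → wf (Lab s n (inp x y P))
  wfout : ∀ s n x y P → wf (Lab s n (out x y P))
  wfωp  : ∀ s n o → wf (Lab s n (ω∙ o))
  wfpar : ∀ {E F} → wf E → wf F → top E ℜ top F → wf (E ∣ₗ F)
  wfν   : ∀ {x E} → wf E → wf (νₗ x E)
  wf!   : ∀ s n P → wf (!ₗ (s , n) P)

data IsProcₗ : LT → Set where
  q𝟘   : IsProcₗ 𝟘ₗ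
  qinp : ∀ {v x y E} → IsProcₗ E → IsProcₗ (inpₗ v x y E)
  qout : ∀ {v x y E} → IsProcₗ E → IsProcₗ (outₗ v x y E)
  qpar : ∀ {E F} → IsProcₗ E → IsProcₗ F → IsProcₗ (E ∣ₗ F)
  qν   : ∀ {x E} → IsProcₗ E → IsProcₗ (νₗ x E)
  q!   : ∀ {v P} → IsProc P → IsProcₗ (!ₗ v P)

InPe : LT → Set
InPe E = wf E × IsProcₗ E

InOe : LT → Set
InOe ρ = wf ρ

fnₗ : LT → List Name
fnₗ 𝟘ₗ            = []
fnₗ (inpₗ v x y E) = x ∷ remove y (fnₗ E)
fnₗ (outₗ v x y E) = x ∷ y ∷ fnₗ E
fnₗ (E ∣ₗ F)      = fnₗ E ++ fnₗ F
fnₗ (νₗ x E)      = remove x (fnₗ E)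
fnₗ (!ₗ v P)      = fn P
fnₗ (ωₗ o)        = fn o

bnAllₗ : LT → List Name
bnAllₗ 𝟘ₗ            = []
bnAllₗ (inpₗ v x y E) = y ∷ bnAllₗ E
bnAllₗ (outₗ v x y E) = bnAllₗ E
bnAllₗ (E ∣ₗ F)      = bnAllₗ E ++ bnAllₗ F
bnAllₗ (νₗ x E)      = x ∷ bnAllₗ E
bnAllₗ (!ₗ v P)      = bnAll P
bnAllₗ (ωₗ o)        = bnAll o

swapₗ : Name → Name → LT → LT
swapₗ a b 𝟘ₗ            = 𝟘ₗ
swapₗ a b (inpₗ v x y E) = inpₗ v (swapN a b x) (swapN a b y) (swapₗ a b E)
swapₗ a b (outₗ v x y E) = outₗ v (swapN a b x) (swapN a b y) (swapₗ a b E)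
swapₗ a b (E ∣ₗ F)      = swapₗ a b E ∣ₗ swapₗ a b F
swapₗ a b (νₗ x E)      = νₗ (swapN a b x) (swapₗ a b E)
swapₗ a b (!ₗ v P)      = !ₗ v (swap a b P)
swapₗ a b (ωₗ o)        = ωₗ (swap a b o)

substₗ : Name → Name → LT → LT
substₗ z y 𝟘ₗ            = 𝟘ₗ
substₗ z y (inpₗ v x b E) with b ≟ y
... | yes _ = inpₗ v (rnN z y x) b E
... | no _  = inpₗ v (rnN z y x) b (substₗ z y E)
substₗ z y (outₗ v x b E) = outₗ v (rnN z y x) (rnN z y b) (substₗ z y E)
substₗ z y (E ∣ₗ F)      = substₗ z y E ∣ₗ substₗ z y F
substₗ z y (νₗ b E) with b ≟ y
... | yes _ = νₗ b E
... | no _  = νₗ b (substₗ z y E)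
substₗ z y (!ₗ v P)      = !ₗ v (subst z y P)
substₗ z y (ωₗ o)        = ωₗ (subst z y o)

data _≈αₗ_ : LT → LT → Set where
  α𝟘    : 𝟘ₗ ≈αₗ 𝟘ₗ
  αinp  : ∀ {v x y E E'} → E ≈αₗ E' → inpₗ v x y E ≈αₗ inpₗ v x y E'
  αinp' : ∀ {v x y y' E E'} → y ≢ y' → y ∉ fnₗ E' → E ≈αₗ swapₗ y y' E' →
          inpₗ v x y E ≈αₗ inpₗ v x y' E'
  αout  : ∀ {v x y E E'} → E ≈αₗ E' → outₗ v x y E ≈αₗ outₗ v x y E'
  αpar  : ∀ {E F E' F'} → E ≈αₗ E' → F ≈αₗ F' → (E ∣ₗ F) ≈αₗ (E' ∣ₗ F')
  αν    : ∀ {y E E'} → E ≈αₗ E' → νₗ y E ≈αₗ νₗ y E'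
  αν'   : ∀ {y y' E E'} → y ≢ y' → y ∉ fnₗ E' → E ≈αₗ swapₗ y y' E' →
          νₗ y E ≈αₗ νₗ y' E'
  α!    : ∀ {v P P'} → P ≈α P' → !ₗ v P ≈αₗ !ₗ v P'
  αω    : ∀ {o o'} → o ≈α o' → ωₗ o ≈αₗ ωₗ o'

infix 4 _⟶ₗ[_]_
data _⟶ₗ[_]_ : LT → Act → LT → Set where
  tInp   : ∀ {v x y z E} → z ∉ bnAllₗ E → inpₗ v x y E ⟶ₗ[ inA x z ] substₗ z y E
  tOut   : ∀ {v x y E} → outₗ v x y E ⟶ₗ[ outA x y ] E
  tOpen  : ∀ {x y E E'} → E ⟶ₗ[ outA x y ] E' → x ≢ y → νₗ y E ⟶ₗ[ boutA x y ] E'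
  tRes   : ∀ {y μ E E'} → E ⟶ₗ[ μ ] E' → y ∉ namesA μ → νₗ y E ⟶ₗ[ μ ] νₗ y E'
  tParL  : ∀ {μ E E' F} → E ⟶ₗ[ μ ] E' → Disj (bnA μ) (fnₗ F) → (E ∣ₗ F) ⟶ₗ[ μ ] (E' ∣ₗ F)
  tParR  : ∀ {μ E F F'} → F ⟶ₗ[ μ ] F' → Disj (bnA μ) (fnₗ E) → (E ∣ₗ F) ⟶ₗ[ μ ] (E ∣ₗ F')
  tComL  : ∀ {x y E E' F F'} → E ⟶ₗ[ inA x y ] E' → F ⟶ₗ[ outA x y ] F' → (E ∣ₗ F) ⟶ₗ[ τ ] (E' ∣ₗ F')
  tComR  : ∀ {x y E E' F F'} → E ⟶ₗ[ outA x y ] E' → F ⟶ₗ[ inA x y ] F' → (E ∣ₗ F) ⟶ₗ[ τ ] (E' ∣ₗ F')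
  tCloseL : ∀ {x y E E' F F'} → E ⟶ₗ[ inA x y ] E' → F ⟶ₗ[ boutA x y ] F' → y ∉ fnₗ E →
            (E ∣ₗ F) ⟶ₗ[ τ ] νₗ y (E' ∣ₗ F')
  tCloseR : ∀ {x y E E' F F'} → E ⟶ₗ[ boutA x y ] E' → F ⟶ₗ[ inA x y ] F' → y ∉ fnₗ F →
            (E ∣ₗ F) ⟶ₗ[ τ ] νₗ y (E' ∣ₗ F')
  tRep   : ∀ {μ s n P P'} → P ⟶[ μ ] P' →
           !ₗ (s , n) P ⟶ₗ[ μ ] (Lab (s ++ [ false ]) (suc n) P' ∣ₗ !ₗ (s ++ [ true ] , suc n) P)
  tAlpha : ∀ {μ E E₁ E₂ E'} → E ≈αₗ E₁ → E₁ ⟶ₗ[ μ ] E₂ → E₂ ≈αₗ E' → E ⟶ₗ[ μ ] E'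

data CanSucc : LT → Set where
  sω    : ∀ {o} → CanSucc (ωₗ o)
  sRes  : ∀ {y E} → CanSucc E → CanSucc (νₗ y E)
  sParL : ∀ {E F} → CanSucc E → CanSucc (E ∣ₗ F)
  sParR : ∀ {E F} → CanSucc F → CanSucc (E ∣ₗ F)
  sRep  : ∀ {v P} → CanSuccU P → CanSucc (!ₗ v P)

data live : Label → Act → LT → Set where
  lInp  : ∀ {v x y z S} → live v (inA x z) (inpₗ v x y S)
  lOut  : ∀ {v x z S} → live v (outA x z) (outₗ v x z S)
  lRes  : ∀ {v μ y S} → live v μ S → y ∉ namesA μ → live v μ (νₗ y S)
  lOpen : ∀ {v x y S} → live v (outA x y) S → x ≢ y → live v (boutA x y) (νₗ y S)
  lRep  : ∀ {μ s n P P'} → P ⟶[ μ ] P' → live (s , n) μ (!ₗ (s , n) P)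
  lParL : ∀ {v μ S₀ S₁} → live v μ S₀ → Disj (bnA μ) (fnₗ S₁) → live v μ (S₀ ∣ₗ S₁)
  lParR : ∀ {v μ S₀ S₁} → live v μ S₁ → Disj (bnA μ) (fnₗ S₀) → live v μ (S₀ ∣ₗ S₁)
  lComL₁ : ∀ {v w x y S₀ S₁} → live v (inA x y) S₀ → live w (outA x y) S₁ → live v τ (S₀ ∣ₗ S₁)
  lComL₂ : ∀ {v w x y S₀ S₁} → live v (inA x y) S₀ → live w (outA x y) S₁ → live w τ (S₀ ∣ₗ S₁)
  lComR₁ : ∀ {v w x y S₀ S₁} → live v (outA x y) S₀ → live w (inA x y) S₁ → live v τ (S₀ ∣ₗ S₁)
  lComR₂ : ∀ {v w x y S₀ S₁} → live v (outA x y) S₀ → live w (inA x y) S₁ → live w τ (S₀ ∣ₗ S₁)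
  lCloseL₁ : ∀ {v w x y S₀ S₁} → live v (inA x y) S₀ → live w (boutA x y) S₁ → y ∉ fnₗ S₀ →
             live v τ (S₀ ∣ₗ S₁)
  lCloseL₂ : ∀ {v w x y S₀ S₁} → live v (inA x y) S₀ → live w (boutA x y) S₁ → y ∉ fnₗ S₀ →
             live w τ (S₀ ∣ₗ S₁)
  lCloseR₁ : ∀ {v w x y S₀ S₁} → live v (boutA x y) S₀ → live w (inA x y) S₁ → y ∉ fnₗ S₁ →
             live v τ (S₀ ∣ₗ S₁)
  lCloseR₂ : ∀ {v w x y S₀ S₁} → live v (boutA x y) S₀ → live w (inA x y) S₁ → y ∉ fnₗ S₁ →
             live w τ (S₀ ∣ₗ S₁)
  lAlpha : ∀ {v μ S S'} → S ≈αₗ S' → live v μ S' → live v μ S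

Ll : LT → Label → Set
Ll S v = live v τ S

-- index range: nothing = infinite computation; just n = states S₀ … Sₙ
InRange : Maybe ℕ → ℕ → Set
InRange nothing  i = ⊤
InRange (just n) i = i ≤ n

record MaxComp (S : LT) : Set where
  field
    st      : ℕ → LT
    len     : Maybe ℕ
    start   : st 0 ≡ S
    steps   : ∀ i → InRange len (suc i) → st i ⟶ₗ[ τ ] st (suc i)
    maximal : ∀ n → len ≡ just n → ∀ T → ¬ (st n ⟶ₗ[ τ ] T)
open MaxComp public

WeakFair : ∀ {S} → MaxComp S → Set
WeakFair c = ∀ (v : Label) i → InRange (len c) i →
  ∃ λ j → i ≤ j × InRange (len c) j × ¬ Ll (st c j) v

StrongFair : ∀ {S} → MaxComp S → Set
StrongFair c = ∀ (v : Label) → ∃ λ i → InRange (len c) i ×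
  (∀ j → i ≤ j → InRange (len c) j → ¬ Ll (st c j) v)

Succeeds : ∀ {S} → MaxComp S → Set
Succeeds c = ∃ λ i → InRange (len c) i × CanSucc (st c i)

sfmust : LT → LT → Set
sfmust E ρ = ∀ (c : MaxComp (E ∣ₗ ρ)) → StrongFair c → Succeeds c

wfmust : LT → LT → Set
wfmust E ρ = ∀ (c : MaxComp (E ∣ₗ ρ)) → WeakFair c → Succeeds c

-- Strong fairness implies weak fairness, so wfmust ⇒ sfmust is immediate.
--
-- For the converse take E = ā0 | !0(y).1̄1 | !1(y).0̄0 and ρ = 1(y).ω: the message ping-pongs
-- between channels 0 and 1 forever unless ρ catches it on channel 1. Up to α-conversion and
-- spent 𝟘 components every reachable system is a parallel composition of a message, the two
-- replicated forwarders and ρ (or ω), and each component's label can be tracked by the number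
-- of `false`s in its string. The labels live while the message sits on channel 0 all have
-- exactly two `false`s, those live while it sits on channel 1 never do, so along the endless
-- ping-pong every label dies every other step and the computation is weak-fair. But the label
-- of ρ is live whenever the message is on channel 1, so a strong-fair computation must
-- eventually let ρ take it, and then ω is enabled.

module Submission where

import Algebra.Properties.CommutativeSemigroup as CommutativeSemigroupProperties
open import Algebra.Bundles using (CommutativeSemigroup)
open import Data.Bool using (Bool; true; false)
open import Data.Empty using (⊥-elim)
open import Data.List using (List; []; _∷_; _++_; [_])
open import Data.List.Relation.Unary.All using ([])
open import Data.List.Relation.Unary.Any using (here; there)
open import Data.Maybe using (nothing; just)
open import Data.Nat using (ℕ; zero; suc; _+_; _≤_; _⊔_; _≟_; z≤n; s≤s)
open import Data.Nat.Properties
  using (+-assoc; +-comm; ≤-refl; ≤-trans; n≤1+n; m≤m+n; m≤n+m; m≤m⊔n; m≤n⊔m; ⊔-lub; ≤∧≢⇒<)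
open import Data.Product using (∃; ∃₂; _×_; _,_; proj₁; proj₂)
open import Data.Sum using (_⊎_; inj₁; inj₂)
open import Data.Unit using (tt)
open import Relation.Binary.PropositionalEquality
  using (_≡_; _≢_; refl; sym; trans; cong; ≢-sym)
open import Relation.Binary.PropositionalEquality.Algebra using (isMagma)
open import Relation.Nullary using (¬_; yes; no)

open import Defs

InRange-pred : ∀ l {i} → InRange l (suc i) → InRange l i
InRange-pred nothing  _   = tt
InRange-pred (just n) {i} i<n = ≤-trans (n≤1+n i) i<n

InRange-⊔ : ∀ l {i j} → InRange l i → InRange l j → InRange l (i ⊔ j)
InRange-⊔ nothing  _ _ = tt
InRange-⊔ (just n) = ⊔-lub

enabled⇒InRange-suc : ∀ {S} (c : MaxComp S) {i T} →
  InRange (len c) i → st c i ⟶ₗ[ τ ] T → InRange (len c) (suc i)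
enabled⇒InRange-suc c {i} {T} i∈ step with len c | maximal c
... | nothing | _ = tt
... | just n  | last-stuck with i ≟ n
...   | yes refl = ⊥-elim (last-stuck i refl T step)
...   | no  i≢n  = ≤∧≢⇒< i∈ i≢n

strongFair⇒weakFair : ∀ {S} (c : MaxComp S) → StrongFair c → WeakFair c
strongFair⇒weakFair c fair v i i∈ with fair v
... | i₀ , i₀∈ , dead = i ⊔ i₀ , m≤m⊔n i i₀ , j∈ , dead (i ⊔ i₀) (m≤n⊔m i i₀) j∈
  where j∈ = InRange-⊔ (len c) i∈ i₀∈

wfmust⇒sfmust : ∀ E ρ → wfmust E ρ → sfmust E ρ
wfmust⇒sfmust E ρ must c fair = must c (strongFair⇒weakFair c fair)

data Forwarder (x w : Name) : Obs → Set where
  forwarder : ∀ {y} → y ≢ w → Forwarder x w (inp x y (out w w 𝟘))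

out-𝟘-≈α : ∀ {x y Q} → out x y 𝟘 ≈α Q → Q ≡ out x y 𝟘
out-𝟘-≈α (αout α𝟘) = refl

out-injective : ∀ {x y P x′ y′ P′} → out x y P ≡ out x′ y′ P′ → x ≡ x′ × y ≡ y′ × P ≡ P′
out-injective refl = refl , refl , refl

swap-≡𝟘 : ∀ {a b} P → swap a b P ≡ 𝟘 → P ≡ 𝟘
swap-≡𝟘 𝟘 _ = refl

swap-≡out-𝟘 : ∀ {a b x y} P → swap a b P ≡ out x y 𝟘 →
  ∃₂ λ p q → P ≡ out p q 𝟘 × swapN a b p ≡ x × swapN a b q ≡ y
swap-≡out-𝟘 (out p q P) eq with out-injective eq
... | refl , refl , P↦𝟘 rewrite swap-≡𝟘 P P↦𝟘 = p , q , refl , refl , refl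

swapN-≡ : ∀ a b p w → a ≢ w → swapN a b p ≡ w → (b ≡ w × p ≡ a) ⊎ (b ≢ w × p ≡ w)
swapN-≡ a b p w a≢w eq with p ≟ a
... | yes refl = inj₁ (eq , refl)
... | no _ with p ≟ b
...   | yes refl = ⊥-elim (a≢w eq)
...   | no  p≢b  = inj₂ ((λ b≡w → p≢b (trans eq (sym b≡w))) , eq)

Forwarder-≈α : ∀ {x w P P′} → Forwarder x w P → P ≈α P′ → Forwarder x w P′
Forwarder-≈α (forwarder y≢w) (αinp body) rewrite out-𝟘-≈α body = forwarder y≢w
Forwarder-≈α {w = w} (forwarder {y} y≢w) (αinp' {y' = y′} {P' = Q} _ y∉Q body)
  with swap-≡out-𝟘 Q (out-𝟘-≈α body)
... | p , q , refl , p↦w , q↦w with swapN-≡ y y′ p w y≢w p↦w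
...   | inj₁ (_ , refl) = ⊥-elim (y∉Q (here refl))
...   | inj₂ (y′≢w , refl) with swapN-≡ y y′ q w y≢w q↦w
...     | inj₁ (_ , refl) = ⊥-elim (y∉Q (there (here refl)))
...     | inj₂ (_ , refl) = forwarder y′≢w

rnN-≢ : ∀ {z y w} → w ≢ y → rnN z y w ≡ w
rnN-≢ {y = y} {w} w≢y with w ≟ y
... | yes w≡y = ⊥-elim (w≢y w≡y)
... | no  _   = refl

Forwarder-transition : ∀ {x w P μ P′} → Forwarder x w P → P ⟶[ μ ] P′ →
  ∃ λ z → μ ≡ inA x z × P′ ≡ out w w 𝟘
Forwarder-transition (forwarder y≢w) (tInp {z = z} _) =
  z , refl , cong (λ u → out u u 𝟘) (rnN-≢ (≢-sym y≢w))
Forwarder-transition f (tAlpha before step after) with Forwarder-transition (Forwarder-≈α f before) step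
... | z , μ≡ , refl = z , μ≡ , out-𝟘-≈α after

Forwarder-inputs-only : ∀ {x w P μ P′} → Forwarder x w P → (∀ z → μ ≢ inA x z) → ¬ (P ⟶[ μ ] P′)
Forwarder-inputs-only f not-input step with Forwarder-transition f step
... | z , μ≡ , _ = not-input z μ≡

record Census : Set where
  constructor census
  field
    #msg₀ #msg₁ #relay #probe #success : ℕ
open Census

infixr 6 _⊕_
_⊕_ : Census → Census → Census
c ⊕ d = census (#msg₀ c + #msg₀ d) (#msg₁ c + #msg₁ d) (#relay c + #relay d)
               (#probe c + #probe d) (#success c + #success d)

census-≡ : ∀ {a b r p s a′ b′ r′ p′ s′} → a ≡ a′ → b ≡ b′ → r ≡ r′ → p ≡ p′ → s ≡ s′ →
  census a b r p s ≡ census a′ b′ r′ p′ s′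
census-≡ refl refl refl refl refl = refl

⊕-assoc : ∀ c d e → (c ⊕ d) ⊕ e ≡ c ⊕ (d ⊕ e)
⊕-assoc c d e = census-≡ (+-assoc (#msg₀ c) _ _) (+-assoc (#msg₁ c) _ _)
  (+-assoc (#relay c) _ _) (+-assoc (#probe c) _ _) (+-assoc (#success c) _ _)

⊕-comm : ∀ c d → c ⊕ d ≡ d ⊕ c
⊕-comm c d = census-≡ (+-comm (#msg₀ c) _) (+-comm (#msg₁ c) _)
  (+-comm (#relay c) _) (+-comm (#probe c) _) (+-comm (#success c) _)

⊕-commutativeSemigroup : CommutativeSemigroup _ _
⊕-commutativeSemigroup = record
  { isCommutativeSemigroup = record
    { isSemigroup = record { isMagma = isMagma _⊕_ ; assoc = ⊕-assoc }
    ; comm        = ⊕-comm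
    }
  }

open CommutativeSemigroupProperties ⊕-commutativeSemigroup using (interchange; x∙yz≈y∙xz)

𝟎 msg₀ msg₁ relay probe success : Census
𝟎       = census 0 0 0 0 0
msg₀    = census 1 0 0 0 0
msg₁    = census 0 1 0 0 0
relay   = census 0 0 1 0 0
probe   = census 0 0 0 1 0
success = census 0 0 0 0 1

msgAt₀ msgAt₁ tested : Census
msgAt₀ = msg₀ ⊕ relay ⊕ probe
msgAt₁ = msg₁ ⊕ relay ⊕ probe
tested = relay ⊕ success

Replaces : Census → Census → Census → Census → Set
Replaces e e′ c c′ = ∃ λ b → c ≡ e ⊕ b × c′ ≡ e′ ⊕ b

Replaces-⊕ʳ : ∀ {e e′ c c′} d → Replaces e e′ c c′ → Replaces e e′ (c ⊕ d) (c′ ⊕ d)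
Replaces-⊕ʳ {e} {e′} d (b , refl , refl) = b ⊕ d , ⊕-assoc e b d , ⊕-assoc e′ b d

Replaces-⊕ˡ : ∀ {e e′ c c′} d → Replaces e e′ c c′ → Replaces e e′ (d ⊕ c) (d ⊕ c′)
Replaces-⊕ˡ {e} {e′} d (b , refl , refl) = d ⊕ b , x∙yz≈y∙xz d e b , x∙yz≈y∙xz d e′ b

Replaces-⊕ : ∀ {e₁ e₁′ c₁ c₁′ e₂ e₂′ c₂ c₂′} →
  Replaces e₁ e₁′ c₁ c₁′ → Replaces e₂ e₂′ c₂ c₂′ →
  Replaces (e₁ ⊕ e₂) (e₁′ ⊕ e₂′) (c₁ ⊕ c₂) (c₁′ ⊕ c₂′)
Replaces-⊕ {e₁} {e₁′} {e₂ = e₂} {e₂′} (b₁ , refl , refl) (b₂ , refl , refl) =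
  b₁ ⊕ b₂ , interchange e₁ b₁ e₂ b₂ , interchange e₁′ b₁ e₂′ b₂

Effect : Set₁
Effect = Census → Census → Set

Via : Effect → Census → Census → Set
Via Eff c c′ = ∃₂ λ e e′ → Eff e e′ × Replaces e e′ c c′

Via-⊕ʳ : ∀ {Eff c c′} d → Via Eff c c′ → Via Eff (c ⊕ d) (c′ ⊕ d)
Via-⊕ʳ d (e , e′ , eff , r) = e , e′ , eff , Replaces-⊕ʳ d r

Via-⊕ˡ : ∀ {Eff c c′} d → Via Eff c c′ → Via Eff (d ⊕ c) (d ⊕ c′)
Via-⊕ˡ d (e , e′ , eff , r) = e , e′ , eff , Replaces-⊕ˡ d r

Via-⊕ : ∀ {Eff₁ Eff₂ Eff c₁ c₁′ c₂ c₂′} →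
  (∀ {e₁ e₁′ e₂ e₂′} → Eff₁ e₁ e₁′ → Eff₂ e₂ e₂′ → Eff (e₁ ⊕ e₂) (e₁′ ⊕ e₂′)) →
  Via Eff₁ c₁ c₁′ → Via Eff₂ c₂ c₂′ → Via Eff (c₁ ⊕ c₂) (c₁′ ⊕ c₂′)
Via-⊕ combine (_ , _ , eff₁ , r₁) (_ , _ , eff₂ , r₂) = _ , _ , combine eff₁ eff₂ , Replaces-⊕ r₁ r₂

data InputEffect : Name → Effect where
  forward₀₁ : InputEffect 0 𝟎 msg₁
  forward₁₀ : InputEffect 1 𝟎 msg₀
  catch     : InputEffect 1 probe success

data OutputEffect : Name → Effect where
  emit₀ : OutputEffect 0 msg₀ 𝟎
  emit₁ : OutputEffect 1 msg₁ 𝟎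

data τEffect : Effect where
  pass₀₁ : τEffect msg₀ msg₁
  pass₁₀ : τEffect msg₁ msg₀
  caught : τEffect (msg₁ ⊕ probe) success

communicate : ∀ {x e₁ e₁′ e₂ e₂′} → InputEffect x e₁ e₁′ → OutputEffect x e₂ e₂′ →
  τEffect (e₁ ⊕ e₂) (e₁′ ⊕ e₂′)
communicate forward₀₁ emit₀ = pass₀₁
communicate forward₁₀ emit₁ = pass₁₀
communicate catch     emit₁ = caught

communicate′ : ∀ {x e₁ e₁′ e₂ e₂′} → OutputEffect x e₁ e₁′ → InputEffect x e₂ e₂′ →
  τEffect (e₁ ⊕ e₂) (e₁′ ⊕ e₂′)
communicate′ emit₀ forward₀₁ = pass₀₁
communicate′ emit₁ forward₁₀ = pass₁₀
communicate′ emit₁ catch     = caught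

falses : List Bool → ℕ
falses []          = 0
falses (false ∷ s) = suc (falses s)
falses (true ∷ s)  = falses s

falses-++-false : ∀ s → falses (s ++ [ false ]) ≡ suc (falses s)
falses-++-false []          = refl
falses-++-false (false ∷ s) = cong suc (falses-++-false s)
falses-++-false (true ∷ s)  = falses-++-false s

falses-++-true : ∀ s → falses (s ++ [ true ]) ≡ falses s
falses-++-true []          = refl
falses-++-true (false ∷ s) = cong suc (falses-++-true s)
falses-++-true (true ∷ s)  = falses-++-true s

probeLabel : Label
probeLabel = true ∷ [] , 0

-- The replicated forwarder from channel 1 back to channel 0 is not counted: no argument needs it.
data Soup : LT → Census → Set where
  ∅         : Soup 𝟘ₗ 𝟎
  ⟨msg₀⟩    : ∀ {s n} → falses s ≡ 2 → Soup (outₗ (s , n) 0 0 𝟘ₗ) msg₀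
  ⟨msg₁⟩    : ∀ {s n} → falses s ≡ 3 → Soup (outₗ (s , n) 1 1 𝟘ₗ) msg₁
  ⟨relay⟩   : ∀ {s n P} → Forwarder 0 1 P → falses s ≡ 2 → Soup (!ₗ (s , n) P) relay
  ⟨back⟩    : ∀ {s n P} → Forwarder 1 0 P → falses s ≡ 1 → Soup (!ₗ (s , n) P) 𝟎
  ⟨probe⟩   : ∀ {y} → Soup (inpₗ probeLabel 1 y (ωₗ 𝟘)) probe
  ⟨success⟩ : Soup (ωₗ 𝟘) success
  _∥_       : ∀ {E F c d} → Soup E c → Soup F d → Soup (E ∣ₗ F) (c ⊕ d)

ωₗ-injective : ∀ {o o′} → ωₗ o ≡ ωₗ o′ → o ≡ o′
ωₗ-injective refl = refl

swapₗ-≡ωₗ𝟘 : ∀ {a b} E → swapₗ a b E ≡ ωₗ 𝟘 → E ≡ ωₗ 𝟘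
swapₗ-≡ωₗ𝟘 (ωₗ o) eq = cong ωₗ (swap-≡𝟘 o (ωₗ-injective eq))

ωₗ𝟘-≈αₗ : ∀ {E} → ωₗ 𝟘 ≈αₗ E → E ≡ ωₗ 𝟘
ωₗ𝟘-≈αₗ (αω α𝟘) = refl

Soup-≈αₗ : ∀ {S S′ c} → Soup S c → S ≈αₗ S′ → Soup S′ c
Soup-≈αₗ ∅             α𝟘             = ∅
Soup-≈αₗ (⟨msg₀⟩ fs)   (αout α𝟘)      = ⟨msg₀⟩ fs
Soup-≈αₗ (⟨msg₁⟩ fs)   (αout α𝟘)      = ⟨msg₁⟩ fs
Soup-≈αₗ (⟨relay⟩ f fs) (α! α)        = ⟨relay⟩ (Forwarder-≈α f α) fs
Soup-≈αₗ (⟨back⟩ f fs)  (α! α)        = ⟨back⟩ (Forwarder-≈α f α) fs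
Soup-≈αₗ ⟨probe⟩       (αinp α) rewrite ωₗ𝟘-≈αₗ α = ⟨probe⟩
Soup-≈αₗ ⟨probe⟩       (αinp' {E' = E} _ _ α) rewrite swapₗ-≡ωₗ𝟘 E (ωₗ𝟘-≈αₗ α) = ⟨probe⟩
Soup-≈αₗ ⟨success⟩     (αω α𝟘)        = ⟨success⟩
Soup-≈αₗ (s ∥ t)       (αpar α β)     = Soup-≈αₗ s α ∥ Soup-≈αₗ t β

Evolves : LT → Census → Effect → Set
Evolves S′ c Eff = ∃ λ c′ → Soup S′ c′ × Via Eff c c′

Evolves-≈αₗ : ∀ {S′ S″ c Eff} → S′ ≈αₗ S″ → Evolves S′ c Eff → Evolves S″ c Eff
Evolves-≈αₗ α (c′ , s′ , via) = c′ , Soup-≈αₗ s′ α , via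

Evolves-∥ : ∀ {S′ T′ c d Eff₁ Eff₂ Eff} →
  (∀ {e₁ e₁′ e₂ e₂′} → Eff₁ e₁ e₁′ → Eff₂ e₂ e₂′ → Eff (e₁ ⊕ e₂) (e₁′ ⊕ e₂′)) →
  Evolves S′ c Eff₁ → Evolves T′ d Eff₂ → Evolves (S′ ∣ₗ T′) (c ⊕ d) Eff
Evolves-∥ combine (c′ , s′ , via) (d′ , t′ , via′) = c′ ⊕ d′ , s′ ∥ t′ , Via-⊕ combine via via′

Evolves-∥ˡ : ∀ {S′ c Eff F} d → Soup F d → Evolves S′ c Eff → Evolves (S′ ∣ₗ F) (c ⊕ d) Eff
Evolves-∥ˡ d t (c′ , s′ , via) = c′ ⊕ d , s′ ∥ t , Via-⊕ʳ d via

Evolves-∥ʳ : ∀ {S′ c Eff E} d → Soup E d → Evolves S′ c Eff → Evolves (E ∣ₗ S′) (d ⊕ c) Eff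
Evolves-∥ʳ d s (c′ , t′ , via) = d ⊕ c′ , s ∥ t′ , Via-⊕ˡ d via

input-step : ∀ {S S′ c x z} → Soup S c → S ⟶ₗ[ inA x z ] S′ → Evolves S′ c (InputEffect x)
input-step s (tAlpha before step after) = Evolves-≈αₗ after (input-step (Soup-≈αₗ s before) step)
input-step (⟨relay⟩ {s} f fs) (tRep step) with Forwarder-transition f step
... | _ , refl , refl =
  _ , ⟨msg₁⟩ (trans (falses-++-false s) (cong suc fs)) ∥ ⟨relay⟩ f (trans (falses-++-true s) fs)
    , _ , _ , forward₀₁ , _ , refl , refl
input-step (⟨back⟩ {s} f fs) (tRep step) with Forwarder-transition f step
... | _ , refl , refl =
  _ , ⟨msg₀⟩ (trans (falses-++-false s) (cong suc fs)) ∥ ⟨back⟩ f (trans (falses-++-true s) fs)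
    , _ , _ , forward₁₀ , _ , refl , refl
input-step ⟨probe⟩ (tInp _) = _ , ⟨success⟩ , _ , _ , catch , _ , refl , refl
input-step (_∥_ {d = d} s t) (tParL step _) = Evolves-∥ˡ d t (input-step s step)
input-step (_∥_ {c = c} s t) (tParR step _) = Evolves-∥ʳ c s (input-step t step)

output-step : ∀ {S S′ c x y} → Soup S c → S ⟶ₗ[ outA x y ] S′ → Evolves S′ c (OutputEffect x)
output-step s (tAlpha before step after) = Evolves-≈αₗ after (output-step (Soup-≈αₗ s before) step)
output-step (⟨msg₀⟩ _) tOut = _ , ∅ , _ , _ , emit₀ , _ , refl , refl
output-step (⟨msg₁⟩ _) tOut = _ , ∅ , _ , _ , emit₁ , _ , refl , refl
output-step (⟨relay⟩ f _) (tRep step) = ⊥-elim (Forwarder-inputs-only f (λ _ ()) step)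
output-step (⟨back⟩ f _) (tRep step) = ⊥-elim (Forwarder-inputs-only f (λ _ ()) step)
output-step (_∥_ {d = d} s t) (tParL step _) = Evolves-∥ˡ d t (output-step s step)
output-step (_∥_ {c = c} s t) (tParR step _) = Evolves-∥ʳ c s (output-step t step)

no-bound-output : ∀ {S S′ c x y} → Soup S c → ¬ (S ⟶ₗ[ boutA x y ] S′)
no-bound-output s (tAlpha before step _) = no-bound-output (Soup-≈αₗ s before) step
no-bound-output (⟨relay⟩ f _) (tRep step) = Forwarder-inputs-only f (λ _ ()) step
no-bound-output (⟨back⟩ f _) (tRep step) = Forwarder-inputs-only f (λ _ ()) step
no-bound-output (s ∥ _) (tParL step _) = no-bound-output s step
no-bound-output (_ ∥ t) (tParR step _) = no-bound-output t step

τ-step : ∀ {S S′ c} → Soup S c → S ⟶ₗ[ τ ] S′ → Evolves S′ c τEffect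
τ-step s (tAlpha before step after) = Evolves-≈αₗ after (τ-step (Soup-≈αₗ s before) step)
τ-step (⟨relay⟩ f _) (tRep step) = ⊥-elim (Forwarder-inputs-only f (λ _ ()) step)
τ-step (⟨back⟩ f _) (tRep step) = ⊥-elim (Forwarder-inputs-only f (λ _ ()) step)
τ-step (_∥_ {d = d} s t) (tParL step _) = Evolves-∥ˡ d t (τ-step s step)
τ-step (_∥_ {c = c} s t) (tParR step _) = Evolves-∥ʳ c s (τ-step t step)
τ-step (s ∥ t) (tComL input output) = Evolves-∥ communicate (input-step s input) (output-step t output)
τ-step (s ∥ t) (tComR output input) = Evolves-∥ communicate′ (output-step s output) (input-step t input)
τ-step (_ ∥ t) (tCloseL _ output _) = ⊥-elim (no-bound-output t output)
τ-step (s ∥ _) (tCloseR output _ _) = ⊥-elim (no-bound-output s output)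

msgAt₀-τ : ∀ {S S′} → Soup S msgAt₀ → S ⟶ₗ[ τ ] S′ → Soup S′ msgAt₁
msgAt₀-τ s step with τ-step s step
... | _ , s′ , _ , _ , pass₀₁ , census _ _ _ _ _ , refl , refl = s′
... | _ , _  , _ , _ , pass₁₀ , census _ _ _ _ _ , () , _
... | _ , _  , _ , _ , caught , census _ _ _ _ _ , () , _

msgAt₁-τ : ∀ {S S′} → Soup S msgAt₁ → S ⟶ₗ[ τ ] S′ → Soup S′ msgAt₀ ⊎ Soup S′ tested
msgAt₁-τ s step with τ-step s step
... | _ , _  , _ , _ , pass₀₁ , census _ _ _ _ _ , () , _
... | _ , s′ , _ , _ , pass₁₀ , census _ _ _ _ _ , refl , refl = inj₁ s′
... | _ , s′ , _ , _ , caught , census _ _ _ _ _ , refl , refl = inj₂ s′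

tested-stuck : ∀ {S S′} → Soup S tested → ¬ (S ⟶ₗ[ τ ] S′)
tested-stuck s step with τ-step s step
... | _ , _ , _ , _ , pass₀₁ , census _ _ _ _ _ , () , _
... | _ , _ , _ , _ , pass₁₀ , census _ _ _ _ _ , () , _
... | _ , _ , _ , _ , caught , census _ _ _ _ _ , () , _

data OnChannel : Name → Label → Set where
  channel₀ : ∀ {s n} → falses s ≡ 2 → OnChannel 0 (s , n)
  channel₁ : ∀ {s n} → falses s ≢ 2 → OnChannel 1 (s , n)

≡-≢2 : ∀ {m k} → m ≡ k → k ≢ 2 → m ≢ 2
≡-≢2 refl k≢2 = k≢2

pending : Name → Census → ℕ
pending 0             = #msg₀
pending 1             = #msg₁
pending (suc (suc _)) = λ _ → 0

pending-⊕ʳ : ∀ x {c} d → 1 ≤ pending x c → 1 ≤ pending x (c ⊕ d)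
pending-⊕ʳ 0 d h = ≤-trans h (m≤m+n _ _)
pending-⊕ʳ 1 d h = ≤-trans h (m≤m+n _ _)

pending-⊕ˡ : ∀ x {c} d → 1 ≤ pending x c → 1 ≤ pending x (d ⊕ c)
pending-⊕ˡ 0 d h = ≤-trans h (m≤n+m _ _)
pending-⊕ˡ 1 d h = ≤-trans h (m≤n+m _ _)

LiveSend : Census → Label → Set
LiveSend c v = ∃ λ x → OnChannel x v × 1 ≤ pending x c

LiveSend-⊕ʳ : ∀ {c v} d → LiveSend c v → LiveSend (c ⊕ d) v
LiveSend-⊕ʳ d (x , on , h) = x , on , pending-⊕ʳ x d h

LiveSend-⊕ˡ : ∀ {c v} d → LiveSend c v → LiveSend (d ⊕ c) v
LiveSend-⊕ˡ d (x , on , h) = x , on , pending-⊕ˡ x d h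

live-input : ∀ {S c v x z} → Soup S c → live v (inA x z) S → OnChannel x v
live-input s (lAlpha α l) = live-input (Soup-≈αₗ s α) l
live-input ⟨probe⟩ lInp = channel₁ (λ ())
live-input (⟨relay⟩ f fs) (lRep step) with Forwarder-transition f step
... | _ , refl , _ = channel₀ fs
live-input (⟨back⟩ f fs) (lRep step) with Forwarder-transition f step
... | _ , refl , _ = channel₁ (≡-≢2 fs λ ())
live-input (s ∥ _) (lParL l _) = live-input s l
live-input (_ ∥ t) (lParR l _) = live-input t l

live-output : ∀ {S c v x y} → Soup S c → live v (outA x y) S → OnChannel x v × 1 ≤ pending x c
live-output s (lAlpha α l) = live-output (Soup-≈αₗ s α) l
live-output (⟨msg₀⟩ fs)   lOut = channel₀ fs , ≤-refl
live-output (⟨msg₁⟩ fs)   lOut = channel₁ (≡-≢2 fs λ ()) , ≤-refl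
live-output (⟨relay⟩ f _) (lRep step) = ⊥-elim (Forwarder-inputs-only f (λ _ ()) step)
live-output (⟨back⟩ f _) (lRep step) = ⊥-elim (Forwarder-inputs-only f (λ _ ()) step)
live-output {x = x} (_∥_ {d = d} s _) (lParL l _) with live-output s l
... | on , h = on , pending-⊕ʳ x d h
live-output {x = x} (_∥_ {c = c} _ t) (lParR l _) with live-output t l
... | on , h = on , pending-⊕ˡ x c h

no-live-bound-output : ∀ {S c v x y} → Soup S c → ¬ live v (boutA x y) S
no-live-bound-output s (lAlpha α l) = no-live-bound-output (Soup-≈αₗ s α) l
no-live-bound-output (⟨relay⟩ f _) (lRep step) = Forwarder-inputs-only f (λ _ ()) step
no-live-bound-output (⟨back⟩ f _) (lRep step) = Forwarder-inputs-only f (λ _ ()) step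
no-live-bound-output (s ∥ _) (lParL l _) = no-live-bound-output s l
no-live-bound-output (_ ∥ t) (lParR l _) = no-live-bound-output t l

live-τ : ∀ {S c v} → Soup S c → live v τ S → LiveSend c v
live-τ s (lAlpha α l) = live-τ (Soup-≈αₗ s α) l
live-τ (⟨relay⟩ f _) (lRep step) = ⊥-elim (Forwarder-inputs-only f (λ _ ()) step)
live-τ (⟨back⟩ f _) (lRep step) = ⊥-elim (Forwarder-inputs-only f (λ _ ()) step)
live-τ (_∥_ {d = d} s _) (lParL l _) = LiveSend-⊕ʳ d (live-τ s l)
live-τ (_∥_ {c = c} _ t) (lParR l _) = LiveSend-⊕ˡ c (live-τ t l)
live-τ (_∥_ {c = c} s t) (lComL₁ li lo) = LiveSend-⊕ˡ c (_ , live-input s li , proj₂ (live-output t lo))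
live-τ (_∥_ {c = c} _ t) (lComL₂ _ lo)  = LiveSend-⊕ˡ c (_ , live-output t lo)
live-τ (_∥_ {d = d} s _) (lComR₁ lo _)  = LiveSend-⊕ʳ d (_ , live-output s lo)
live-τ (_∥_ {d = d} s t) (lComR₂ lo li) = LiveSend-⊕ʳ d (_ , live-input t li , proj₂ (live-output s lo))
live-τ (_ ∥ t) (lCloseL₁ _ lo _) = ⊥-elim (no-live-bound-output t lo)
live-τ (_ ∥ t) (lCloseL₂ _ lo _) = ⊥-elim (no-live-bound-output t lo)
live-τ (s ∥ _) (lCloseR₁ lo _ _) = ⊥-elim (no-live-bound-output s lo)
live-τ (s ∥ _) (lCloseR₂ lo _ _) = ⊥-elim (no-live-bound-output s lo)

msgAt₀-live : ∀ {S v} → Soup S msgAt₀ → Ll S v → falses (proj₁ v) ≡ 2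
msgAt₀-live s l with live-τ s l
... | 0 , channel₀ two , _ = two
... | 1 , channel₁ _   , ()

msgAt₁-live : ∀ {S v} → Soup S msgAt₁ → Ll S v → falses (proj₁ v) ≢ 2
msgAt₁-live s l with live-τ s l
... | 0 , channel₀ _     , ()
... | 1 , channel₁ not-2 , _ = not-2

1≤m+n⇒1≤m⊎1≤n : ∀ m {n} → 1 ≤ m + n → 1 ≤ m ⊎ 1 ≤ n
1≤m+n⇒1≤m⊎1≤n zero    h = inj₂ h
1≤m+n⇒1≤m⊎1≤n (suc m) _ = inj₁ (s≤s z≤n)

msg₀-output : ∀ {S c} → Soup S c → 1 ≤ #msg₀ c → ∃ λ S′ → S ⟶ₗ[ outA 0 0 ] S′
msg₀-output (⟨msg₀⟩ _) _ = _ , tOut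
msg₀-output (_∥_ {c = c} s t) h with 1≤m+n⇒1≤m⊎1≤n (#msg₀ c) h
... | inj₁ hs = _ , tParL (proj₂ (msg₀-output s hs)) []
... | inj₂ ht = _ , tParR (proj₂ (msg₀-output t ht)) []

relay-input : ∀ {S c} → Soup S c → 1 ≤ #relay c → ∃ λ S′ → S ⟶ₗ[ inA 0 0 ] S′
relay-input (⟨relay⟩ (forwarder _) _) _ = _ , tRep (tInp λ ())
relay-input (_∥_ {c = c} s t) h with 1≤m+n⇒1≤m⊎1≤n (#relay c) h
... | inj₁ hs = _ , tParL (proj₂ (relay-input s hs)) []
... | inj₂ ht = _ , tParR (proj₂ (relay-input t ht)) []

msg₀-relay-τ : ∀ {S c} → Soup S c → 1 ≤ #msg₀ c → 1 ≤ #relay c → ∃ λ S′ → S ⟶ₗ[ τ ] S′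
msg₀-relay-τ (⟨msg₀⟩ _) _ ()
msg₀-relay-τ (⟨relay⟩ _ _) () _
msg₀-relay-τ (_∥_ {c = c} s t) hm hr with 1≤m+n⇒1≤m⊎1≤n (#msg₀ c) hm | 1≤m+n⇒1≤m⊎1≤n (#relay c) hr
... | inj₁ ms | inj₁ rs = _ , tParL (proj₂ (msg₀-relay-τ s ms rs)) []
... | inj₂ mt | inj₂ rt = _ , tParR (proj₂ (msg₀-relay-τ t mt rt)) []
... | inj₁ ms | inj₂ rt = _ , tComR (proj₂ (msg₀-output s ms)) (proj₂ (relay-input t rt))
... | inj₂ mt | inj₁ rs = _ , tComL (proj₂ (relay-input s rs)) (proj₂ (msg₀-output t mt))

msg₁-live-output : ∀ {S c} → Soup S c → 1 ≤ #msg₁ c → ∃ λ w → live w (outA 1 1) S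
msg₁-live-output (⟨msg₁⟩ _) _ = _ , lOut
msg₁-live-output (_∥_ {c = c} s t) h with 1≤m+n⇒1≤m⊎1≤n (#msg₁ c) h
... | inj₁ hs = _ , lParL (proj₂ (msg₁-live-output s hs)) []
... | inj₂ ht = _ , lParR (proj₂ (msg₁-live-output t ht)) []

probe-live-input : ∀ {S c} → Soup S c → 1 ≤ #probe c → live probeLabel (inA 1 1) S
probe-live-input ⟨probe⟩ _ = lInp
probe-live-input (_∥_ {c = c} s t) h with 1≤m+n⇒1≤m⊎1≤n (#probe c) h
... | inj₁ hs = lParL (probe-live-input s hs) []
... | inj₂ ht = lParR (probe-live-input t ht) []

msg₁-probe-live : ∀ {S c} → Soup S c → 1 ≤ #msg₁ c → 1 ≤ #probe c → Ll S probeLabel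
msg₁-probe-live (⟨msg₁⟩ _) _ ()
msg₁-probe-live ⟨probe⟩ () _
msg₁-probe-live (_∥_ {c = c} s t) hm hp with 1≤m+n⇒1≤m⊎1≤n (#msg₁ c) hm | 1≤m+n⇒1≤m⊎1≤n (#probe c) hp
... | inj₁ ms | inj₁ ps = lParL (msg₁-probe-live s ms ps) []
... | inj₂ mt | inj₂ pt = lParR (msg₁-probe-live t mt pt) []
... | inj₁ ms | inj₂ pt = lComR₂ (proj₂ (msg₁-live-output s ms)) (probe-live-input t pt)
... | inj₂ mt | inj₁ ps = lComL₁ (probe-live-input s ps) (proj₂ (msg₁-live-output t mt))

success⇒CanSucc : ∀ {S c} → Soup S c → 1 ≤ #success c → CanSucc S
success⇒CanSucc ⟨success⟩ _ = sω
success⇒CanSucc (_∥_ {c = c} s t) h with 1≤m+n⇒1≤m⊎1≤n (#success c) h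
... | inj₁ hs = sParL (success⇒CanSucc s hs)
... | inj₂ ht = sParR (success⇒CanSucc t ht)

CanSucc⇒success : ∀ {S c} → Soup S c → CanSucc S → 1 ≤ #success c
CanSucc⇒success ⟨success⟩ _ = s≤s z≤n
CanSucc⇒success (⟨relay⟩ (forwarder _) _) (sRep ())
CanSucc⇒success (⟨back⟩ (forwarder _) _) (sRep ())
CanSucc⇒success (_∥_ {d = d} s _) (sParL ω) = ≤-trans (CanSucc⇒success s ω) (m≤m+n _ (#success d))
CanSucc⇒success (_∥_ {c = c} _ t) (sParR ω) = ≤-trans (CanSucc⇒success t ω) (m≤n+m _ (#success c))

data Phase (S : LT) : Set where
  at₀  : Soup S msgAt₀ → Phase S
  at₁  : Soup S msgAt₁ → Phase S
  done : Soup S tested → Phase S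

Phase-τ : ∀ {S S′} → Phase S → S ⟶ₗ[ τ ] S′ → Phase S′
Phase-τ (at₀ s) step = at₁ (msgAt₀-τ s step)
Phase-τ (at₁ s) step with msgAt₁-τ s step
... | inj₁ s′ = at₀ s′
... | inj₂ s′ = done s′
Phase-τ (done s) step = ⊥-elim (tested-stuck s step)

Phase-reachable : ∀ {S} → Phase S → (c : MaxComp S) → ∀ i → InRange (len c) i → Phase (st c i)
Phase-reachable p c zero    _  rewrite start c = p
Phase-reachable p c (suc i) i∈ =
  Phase-τ (Phase-reachable p c i (InRange-pred (len c) i∈)) (steps c i i∈)

-- At an index after which the probe label is dead the state cannot be at msgAt₁, where that
-- label is live, nor at msgAt₀, whose successor is at msgAt₁.
Phase-sfmust : ∀ {S} → Phase S → (c : MaxComp S) → StrongFair c → Succeeds c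
Phase-sfmust p c fair with fair probeLabel
... | i , i∈ , probe-dead with Phase-reachable p c i i∈
... | done s = i , i∈ , success⇒CanSucc s (s≤s z≤n)
... | at₁ s  = ⊥-elim (probe-dead i ≤-refl i∈ (msg₁-probe-live s (s≤s z≤n) (s≤s z≤n)))
... | at₀ s  with msg₀-relay-τ s (s≤s z≤n) (s≤s z≤n)
...   | _ , step = ⊥-elim (probe-dead (suc i) (n≤1+n i) i+1∈
                     (msg₁-probe-live (msgAt₀-τ s (steps c i i+1∈)) (s≤s z≤n) (s≤s z≤n)))
  where i+1∈ = enabled⇒InRange-suc c i∈ step

forward : Name → Name → Obs
forward x w = inp x 2 (out w w 𝟘)

relayTag backTag : List Bool
relayTag = false ∷ true ∷ false ∷ []
backTag  = false ∷ true ∷ true ∷ []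

E₀ ρ₀ : LT
E₀ = outₗ (false ∷ false ∷ [] , 0) 0 0 𝟘ₗ
     ∣ₗ (!ₗ (relayTag , 0) (forward 0 1) ∣ₗ !ₗ (backTag , 0) (forward 1 0))
ρ₀ = inpₗ probeLabel 1 2 (ωₗ 𝟘)

-- !_{⟨s,n⟩} P after k firings whose spawned copies are all spent, and the same after one
-- more firing whose copy has evolved to Q.
spent : List Bool → ℕ → ℕ → Obs → LT
spent s n zero    P = !ₗ (s , n) P
spent s n (suc k) P = 𝟘ₗ ∣ₗ spent (s ++ [ true ]) (suc n) k P

firing : List Bool → ℕ → ℕ → Obs → Obs → LT
firing s n zero    P Q = Lab (s ++ [ false ]) (suc n) Q ∣ₗ !ₗ (s ++ [ true ] , suc n) P
firing s n (suc k) P Q = 𝟘ₗ ∣ₗ firing (s ++ [ true ]) (suc n) k P Q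

spent-fire : ∀ {P Q x z} s n k → P ⟶[ inA x z ] Q → spent s n k P ⟶ₗ[ inA x z ] firing s n k P Q
spent-fire s n zero    step = tRep step
spent-fire s n (suc k) step = tParR (spent-fire (s ++ [ true ]) (suc n) k step) []

firing-send : ∀ s n k P w → firing s n k P (out w w 𝟘) ⟶ₗ[ outA w w ] spent s n (suc k) P
firing-send s n zero    P w = tParL tOut []
firing-send s n (suc k) P w = tParR (firing-send (s ++ [ true ]) (suc n) k P w) []

spent-Soup : ∀ {P f c} → (∀ {s n} → falses s ≡ f → Soup (!ₗ (s , n) P) c) →
  ∀ s n k → falses s ≡ f → Soup (spent s n k P) c
spent-Soup rep s n zero    fs = rep fs
spent-Soup rep s n (suc k) fs = ∅ ∥ spent-Soup rep (s ++ [ true ]) (suc n) k (trans (falses-++-true s) fs)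

firing-Soup : ∀ {P w f c m} → (∀ {s n} → falses s ≡ f → Soup (!ₗ (s , n) P) c) →
  (∀ {s n} → falses s ≡ suc f → Soup (outₗ (s , n) w w 𝟘ₗ) m) →
  ∀ s n k → falses s ≡ f → Soup (firing s n k P (out w w 𝟘)) (m ⊕ c)
firing-Soup rep msg s n zero fs =
  msg (trans (falses-++-false s) (cong suc fs)) ∥ rep (trans (falses-++-true s) fs)
firing-Soup rep msg s n (suc k) fs =
  ∅ ∥ firing-Soup rep msg (s ++ [ true ]) (suc n) k (trans (falses-++-true s) fs)

ping pong : ℕ → LT
ping zero    = E₀
ping (suc k) = 𝟘ₗ ∣ₗ (spent relayTag 0 (suc k) (forward 0 1) ∣ₗ firing backTag 0 k (forward 1 0) (out 0 0 𝟘))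
pong k       = 𝟘ₗ ∣ₗ (firing relayTag 0 k (forward 0 1) (out 1 1 𝟘) ∣ₗ spent backTag 0 k (forward 1 0))

ping-pong : ∀ k → ping k ⟶ₗ[ τ ] pong k
ping-pong zero    = tComR tOut (tParL (spent-fire relayTag 0 0 (tInp λ ())) [])
ping-pong (suc k) = tParR (tComL (spent-fire relayTag 0 (suc k) (tInp λ ())) (firing-send backTag 0 k _ 0)) []

pong-ping : ∀ k → pong k ⟶ₗ[ τ ] ping (suc k)
pong-ping k = tParR (tComR (firing-send relayTag 0 k _ 1) (spent-fire backTag 0 k (tInp λ ()))) []

relay-Soup : ∀ {s n} → falses s ≡ 2 → Soup (!ₗ (s , n) (forward 0 1)) relay
relay-Soup = ⟨relay⟩ (forwarder λ ())

back-Soup : ∀ {s n} → falses s ≡ 1 → Soup (!ₗ (s , n) (forward 1 0)) 𝟎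
back-Soup = ⟨back⟩ (forwarder λ ())

ping-Soup : ∀ k → Soup (ping k ∣ₗ ρ₀) msgAt₀
ping-Soup zero    = (⟨msg₀⟩ refl ∥ (relay-Soup refl ∥ back-Soup refl)) ∥ ⟨probe⟩
ping-Soup (suc k) =
  (∅ ∥ (spent-Soup relay-Soup relayTag 0 (suc k) refl ∥ firing-Soup back-Soup ⟨msg₀⟩ backTag 0 k refl)) ∥ ⟨probe⟩

pong-Soup : ∀ k → Soup (pong k ∣ₗ ρ₀) msgAt₁
pong-Soup k =
  (∅ ∥ (firing-Soup relay-Soup ⟨msg₁⟩ relayTag 0 k refl ∥ spent-Soup back-Soup backTag 0 k refl)) ∥ ⟨probe⟩

board : ℕ × Bool → LT
board (k , false) = ping k ∣ₗ ρ₀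
board (k , true)  = pong k ∣ₗ ρ₀

next : ℕ × Bool → ℕ × Bool
next (k , false) = k , true
next (k , true)  = suc k , false

rally : ℕ → ℕ × Bool
rally zero    = 0 , false
rally (suc i) = next (rally i)

board-step : ∀ r → board r ⟶ₗ[ τ ] board (next r)
board-step (k , false) = tParL (ping-pong k) []
board-step (k , true)  = tParL (pong-ping k) []

board-dead-now-or-next : ∀ r v → ¬ Ll (board r) v ⊎ ¬ Ll (board (next r)) v
board-dead-now-or-next (k , false) v with falses (proj₁ v) ≟ 2
... | yes two = inj₂ λ l → msgAt₁-live (pong-Soup k) l two
... | no not-2 = inj₁ λ l → not-2 (msgAt₀-live (ping-Soup k) l)
board-dead-now-or-next (k , true) v with falses (proj₁ v) ≟ 2
... | yes two = inj₁ λ l → msgAt₁-live (pong-Soup k) l two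
... | no not-2 = inj₂ λ l → not-2 (msgAt₀-live (ping-Soup (suc k)) l)

board-unsuccessful : ∀ r → ¬ CanSucc (board r)
board-unsuccessful (k , false) ω with CanSucc⇒success (ping-Soup k) ω
... | ()
board-unsuccessful (k , true)  ω with CanSucc⇒success (pong-Soup k) ω
... | ()

endless-rally : MaxComp (E₀ ∣ₗ ρ₀)
endless-rally = record
  { st      = λ i → board (rally i)
  ; len     = nothing
  ; start   = refl
  ; steps   = λ i _ → board-step (rally i)
  ; maximal = λ _ ()
  }

endless-rally-weakFair : WeakFair endless-rally
endless-rally-weakFair v i _ with board-dead-now-or-next (rally i) v
... | inj₁ dead = i , ≤-refl , tt , dead
... | inj₂ dead = suc i , n≤1+n i , tt , dead

E₀-not-wfmust : ¬ wfmust E₀ ρ₀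
E₀-not-wfmust must with must endless-rally endless-rally-weakFair
... | i , _ , ω = board-unsuccessful (rally i) ω

E₀-sfmust : sfmust E₀ ρ₀
E₀-sfmust = Phase-sfmust (at₀ (ping-Soup 0))

E₀-wf : wf E₀
E₀-wf = wfpar (wfout _ 0 0 0 𝟘) (wfpar (wf! relayTag 0 _) (wf! backTag 0 _) relay∣back) msg∣relays
  where
  relay∣back : top (!ₗ (relayTag , 0) (forward 0 1)) ℜ top (!ₗ (backTag , 0) (forward 1 0))
  relay∣back _ _ (here refl) (here refl) = (λ { (_ , ()) }) , (λ { (_ , ()) })
  msg∣relays : top (outₗ (false ∷ false ∷ [] , 0) 0 0 𝟘ₗ)
             ℜ top (!ₗ (relayTag , 0) (forward 0 1) ∣ₗ !ₗ (backTag , 0) (forward 1 0))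
  msg∣relays _ _ (here refl) (here refl)         = (λ { (_ , ()) }) , (λ { (_ , ()) })
  msg∣relays _ _ (here refl) (there (here refl)) = (λ { (_ , ()) }) , (λ { (_ , ()) })

E₀-process : IsProcₗ E₀
E₀-process = qpar (qout q𝟘) (qpar (q! (pinp (pout p𝟘))) (q! (pinp (pout p𝟘))))

proposition6p2 : (∀ (E ρ : LT) → InPe E → InOe ρ → wfmust E ρ → sfmust E ρ)
                 × (∃ λ (E : LT) → ∃ λ (ρ : LT) → InPe E × InOe ρ × sfmust E ρ × ¬ wfmust E ρ)
proposition6p2 =
  (λ E ρ _ _ → wfmust⇒sfmust E ρ) ,
  (E₀ , ρ₀ , (E₀-wf , E₀-process) , wfinp (true ∷ []) 0 1 2 (ω∙ 𝟘) , E₀-sfmust , E₀-not-wfmust)
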